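{- Let $E$ be a finite set and let $P$ be a nonempty family of nonempty pairwise disjoint subsets of $E$ (so $P$ is a partition of $\bigcup P\subseteq E$). Let $M_E(P)=(E,\mathcal{I}_P)$ where $\mathcal{I}_P=\{X\subseteq\bigcup P: |X\cap D|\le 1 \text{ for all } D\in P\}$. Then $F(M_E(P))=P$.
   Context: $M_E(P)$ is a matroid (a unique partition matroid). For a matroid $M=(E,\mathcal{I})$ with $r(M)>0$: $r(M)$ is the common cardinality of bases, $r(X)$ is the rank of $X\subseteq E$ (maximum size of an independent subset of $X$), $s(M)=\{A\in\mathcal{I}: |A|=r(M)-1\}$, $K_M(X)=\{a\in E: r(X\cup\{a\})=r(X)+1\}$ for $X\subseteq E$, and $F(M)=\{K_M(X): X\in s(M)\}$. -}

module Defs where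

open import Data.Nat using (ℕ; suc; _≤_; _∸_)
open import Data.Fin using (Fin)
open import Data.Fin.Subset using (Subset; _∈_; _⊆_; _∩_; _∪_; ⁅_⁆; ∣_∣; ⊤; Empty; Nonempty)
open import Data.List using (List)
open import Data.Product using (Σ; ∃; _×_)
open import Relation.Binary.PropositionalEquality using (_≡_; _≢_)
open import Relation.Nullary using (¬_)
import Data.List.Membership.Propositional as LM

-- Ground set E = Fin n.  A finite family of subsets of E is a list of subsets
-- (family taken as a set: membership via list membership).
Family : ℕ → Set
Family n = List (Subset n)

_∈F_ : ∀ {n} → Subset n → Family n → Set
D ∈F P = D LM.∈ P

FamilyNonempty : ∀ {n} → Family n → Set
FamilyNonempty P = ∃ λ D → D ∈F P

MembersNonempty : ∀ {n} → Family n → Set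
MembersNonempty P = ∀ D → D ∈F P → Nonempty D

PairwiseDisjoint : ∀ {n} → Family n → Set
PairwiseDisjoint P = ∀ D D' → D ∈F P → D' ∈F P → D ≢ D' → Empty (D ∩ D')

_∈⋃_ : ∀ {n} → Fin n → Family n → Set
x ∈⋃ P = ∃ λ D → D ∈F P × x ∈ D

IndepP : ∀ {n} → Family n → Subset n → Set
IndepP P X = (∀ x → x ∈ X → x ∈⋃ P) × (∀ D → D ∈F P → ∣ X ∩ D ∣ ≤ 1)

module MatroidNotions {n : ℕ} (Indep : Subset n → Set) where

  IsRank : Subset n → ℕ → Set
  IsRank X k = (Σ (Subset n) λ A → A ⊆ X × Indep A × ∣ A ∣ ≡ k)
             × (∀ A → A ⊆ X → Indep A → ∣ A ∣ ≤ k)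

  IsRankM : ℕ → Set
  IsRankM = IsRank ⊤

  InS : Subset n → Set
  InS A = Indep A × (∀ r → IsRankM r → ∣ A ∣ ≡ r ∸ 1)

  IsK : Subset n → Subset n → Set
  IsK X K = ∀ a → (a ∈ K → ∃ λ k → IsRank X k × IsRank (X ∪ ⁅ a ⁆) (suc k))
                × ((∃ λ k → IsRank X k × IsRank (X ∪ ⁅ a ⁆) (suc k)) → a ∈ K)

  InF : Subset n → Set
  InF K = ∃ λ X → InS X × IsK X K

-- An independent set A contains at most one element of each block, so it is no
-- larger than any set B meeting every block A meets; if A misses a block D, adding
-- an element of B ∩ D keeps it independent, so it is even strictly smaller.
-- Hence the rank is the number of blocks, attained by a transversal, and a set
-- X ∈ s(M) misses some block D: adding a ∈ D raises the rank, while adding a ∉ D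
-- produces no independent set of full rank, which would have to meet D.  Thus
-- K_M(X) = D.  Conversely, removing from a transversal its element of D leaves a
-- set X which becomes a transversal again when any element of D is added, so
-- X ∈ s(M) and K_M(X) = D.

module Submission where

open import Defs
open import Data.Nat using (ℕ; suc; _≤_; _+_; _∸_; z≤n)
open import Data.Nat.Properties
  using (≤-trans; ≤-reflexive; ≤-antisym; +-suc; +-mono-≤; +-comm; 1+n≰n; m∸n+n≡m; module ≤-Reasoning)
open import Data.Fin using (Fin; zero; suc)
open import Data.Fin.Subset
open import Data.Fin.Subset.Properties
  using (p⊆q⇒∣p∣≤∣q∣; ∣⁅x⁆∣≡1; x∈⁅x⁆; x∈⁅y⁆⇒x≡y; x∈p∩q⁺; x∈p∩q⁻; p∩q⊆p; p∩q⊆q; x∈p∪q⁻;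
         p⊆p∪q; q⊆p∪q; x∈p∧x∉q⇒x∈p─q; p─q⊆p; ∪-identityʳ; Empty-unique; ∣⊥∣≡0; nonempty?; ⊆-antisym;
         _∈?_; ⊆⊤; ⊥⊆; ∉⊥)
open import Data.Bool using () renaming (_≟_ to _≟ᵇ_)
open import Data.Vec.Base using ([]; _∷_; here; there)
open import Data.Vec.Properties using (≡-dec)
open import Data.List using ([]; _∷_)
open import Data.List.Relation.Unary.Any using (here; there)
open import Data.List.Relation.Unary.Any.Properties using (¬Any[])
open import Data.Product using (∃; _×_; _,_; proj₁; proj₂)
open import Data.Sum using (_⊎_; inj₁; inj₂)
open import Data.Empty using (⊥-elim)
open import Relation.Nullary using (yes; no)
open import Relation.Nullary.Decidable using (decidable-stable)
open import Relation.Binary.PropositionalEquality using (_≡_; refl; sym; trans; cong; subst; module ≡-Reasoning)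
open import Function using (id)

private
  variable
    n k k′ : ℕ
    x a : Fin n
    p q r : Subset n
    A B D D′ K K′ X : Subset n
    L : Family n

x∈p─q⇒x∉q : (p q : Subset n) → x ∈ p ─ q → x ∉ q
x∈p─q⇒x∉q (inside ∷ p) (outside ∷ q) here ()
x∈p─q⇒x∉q (_ ∷ p) (_ ∷ q) (there x∈p─q) (there x∈q) = x∈p─q⇒x∉q p q x∈p─q x∈q

p⊆q⇒p∩r⊆q∩r : p ⊆ q → p ∩ r ⊆ q ∩ r
p⊆q⇒p∩r⊆q∩r {p = p} {r = r} p⊆q x∈p∩r =
  let x∈p , x∈r = x∈p∩q⁻ p r x∈p∩r in x∈p∩q⁺ (p⊆q x∈p , x∈r)

x∈p⇒⁅x⁆⊆p : x ∈ p → ⁅ x ⁆ ⊆ p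
x∈p⇒⁅x⁆⊆p {x = x} {p = p} x∈p y∈⁅x⁆ = subst (_∈ p) (sym (x∈⁅y⁆⇒x≡y x y∈⁅x⁆)) x∈p

∣p∣≡∣p∩q∣+∣p─q∣ : (p q : Subset n) → ∣ p ∣ ≡ ∣ p ∩ q ∣ + ∣ p ─ q ∣
∣p∣≡∣p∩q∣+∣p─q∣ []            []            = refl
∣p∣≡∣p∩q∣+∣p─q∣ (inside  ∷ p) (inside  ∷ q) = cong suc (∣p∣≡∣p∩q∣+∣p─q∣ p q)
∣p∣≡∣p∩q∣+∣p─q∣ (inside  ∷ p) (outside ∷ q) =
  trans (cong suc (∣p∣≡∣p∩q∣+∣p─q∣ p q)) (sym (+-suc _ _))
∣p∣≡∣p∩q∣+∣p─q∣ (outside ∷ p) (inside  ∷ q) = ∣p∣≡∣p∩q∣+∣p─q∣ p q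
∣p∣≡∣p∩q∣+∣p─q∣ (outside ∷ p) (outside ∷ q) = ∣p∣≡∣p∩q∣+∣p─q∣ p q

x∉p⇒∣p∪⁅x⁆∣≡1+∣p∣ : (p : Subset n) → x ∉ p → ∣ p ∪ ⁅ x ⁆ ∣ ≡ suc ∣ p ∣
x∉p⇒∣p∪⁅x⁆∣≡1+∣p∣ {x = zero}  (inside  ∷ p) x∉p = ⊥-elim (x∉p here)
x∉p⇒∣p∪⁅x⁆∣≡1+∣p∣ {x = zero}  (outside ∷ p) _   = cong (λ s → suc ∣ s ∣) (∪-identityʳ p)
x∉p⇒∣p∪⁅x⁆∣≡1+∣p∣ {x = suc x} (inside  ∷ p) x∉p = cong suc (x∉p⇒∣p∪⁅x⁆∣≡1+∣p∣ p (λ x∈p → x∉p (there x∈p)))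
x∉p⇒∣p∪⁅x⁆∣≡1+∣p∣ {x = suc x} (outside ∷ p) x∉p = x∉p⇒∣p∪⁅x⁆∣≡1+∣p∣ p (λ x∈p → x∉p (there x∈p))

Empty⇒∣p∣≡0 : Empty p → ∣ p ∣ ≡ 0
Empty⇒∣p∣≡0 {n} p=∅ = trans (cong ∣_∣ (Empty-unique p=∅)) (∣⊥∣≡0 n)

Nonempty⇒1≤∣p∣ : Nonempty p → 1 ≤ ∣ p ∣
Nonempty⇒1≤∣p∣ (x , x∈p) = ≤-trans (≤-reflexive (sym (∣⁅x⁆∣≡1 x))) (p⊆q⇒∣p∣≤∣q∣ (x∈p⇒⁅x⁆⊆p x∈p))

MeetsAll : Subset n → Family n → Set
MeetsAll B L = ∀ D → D ∈F L → Nonempty (B ∩ D)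

MissesSome : Subset n → Family n → Set
MissesSome A L = ∃ λ D → D ∈F L × Empty (A ∩ D)

missesSome-or-meetsAll : (A : Subset n) (L : Family n) → MissesSome A L ⊎ MeetsAll A L
missesSome-or-meetsAll A [] = inj₂ (λ _ ())
missesSome-or-meetsAll A (D ∷ L) with nonempty? (A ∩ D) | missesSome-or-meetsAll A L
... | no  A∩D=∅ | _                        = inj₁ (D , here refl , A∩D=∅)
... | yes _     | inj₁ (D′ , D′∈L , A∩D′=∅) = inj₁ (D′ , there D′∈L , A∩D′=∅)
... | yes A∩D≠∅ | inj₂ meets               = inj₂ λ { _ (here refl) → A∩D≠∅ ; D′ (there D′∈L) → meets D′ D′∈L }

disjoint-tail : PairwiseDisjoint (D ∷ L) → PairwiseDisjoint L
disjoint-tail disj D₁ D₂ D₁∈L D₂∈L = disj D₁ D₂ (there D₁∈L) (there D₂∈L)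

same-block : PairwiseDisjoint L → D ∈F L → D′ ∈F L → x ∈ D → x ∈ D′ → D ≡ D′
same-block disj D∈L D′∈L x∈D x∈D′ =
  decidable-stable (≡-dec _≟ᵇ_ _ _) (λ D≢D′ → disj _ _ D∈L D′∈L D≢D′ (_ , x∈p∩q⁺ (x∈D , x∈D′)))

indep-⊆ : A ⊆ B → IndepP L B → IndepP L A
indep-⊆ A⊆B (B⊆⋃ , B-≤1) = (λ x x∈A → B⊆⋃ x (A⊆B x∈A)) ,
                           (λ D D∈L → ≤-trans (p⊆q⇒∣p∣≤∣q∣ (p⊆q⇒p∩r⊆q∩r A⊆B)) (B-≤1 D D∈L))

indep-tail : (∀ {x} → x ∈ A → x ∉ D) → IndepP (D ∷ L) A → IndepP L A
indep-tail {A = A} {L = L} A-avoids-D (A⊆⋃ , A-≤1) = A⊆⋃L , (λ D′ D′∈L → A-≤1 D′ (there D′∈L))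
  where
  A⊆⋃L : ∀ x → x ∈ A → x ∈⋃ L
  A⊆⋃L x x∈A with A⊆⋃ x x∈A
  ... | _  , here refl   , x∈D  = ⊥-elim (A-avoids-D x∈A x∈D)
  ... | D′ , there D′∈L , x∈D′ = D′ , D′∈L , x∈D′

indep-─-head : IndepP (D ∷ L) A → IndepP L (A ─ D)
indep-─-head {D = D} {A = A} indA = indep-tail (x∈p─q⇒x∉q A D) (indep-⊆ (p─q⊆p A D) indA)

indep-∪⁅⁆ : PairwiseDisjoint L → IndepP L X → D ∈F L → Empty (X ∩ D) → a ∈ D → IndepP L (X ∪ ⁅ a ⁆)
indep-∪⁅⁆ {L = L} {X = X} {D = D} {a = a} disj (X⊆⋃ , X-≤1) D∈L X∩D=∅ a∈D = X∪a⊆⋃ , X∪a-≤1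
  where
  X∪a⊆⋃ : ∀ x → x ∈ X ∪ ⁅ a ⁆ → x ∈⋃ L
  X∪a⊆⋃ x x∈X∪a with x∈p∪q⁻ X ⁅ a ⁆ x∈X∪a
  ... | inj₁ x∈X = X⊆⋃ x x∈X
  ... | inj₂ x∈a = D , D∈L , x∈p⇒⁅x⁆⊆p a∈D x∈a
  X∪a-≤1 : ∀ D′ → D′ ∈F L → ∣ (X ∪ ⁅ a ⁆) ∩ D′ ∣ ≤ 1
  X∪a-≤1 D′ D′∈L with a ∈? D′
  ... | yes a∈D′ with same-block disj D∈L D′∈L a∈D a∈D′
  ...   | refl = ≤-trans (p⊆q⇒∣p∣≤∣q∣ ⊆⁅a⁆) (≤-reflexive (∣⁅x⁆∣≡1 a))
    where
    ⊆⁅a⁆ : (X ∪ ⁅ a ⁆) ∩ D ⊆ ⁅ a ⁆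
    ⊆⁅a⁆ {x} h with x∈p∩q⁻ (X ∪ ⁅ a ⁆) D h
    ... | x∈X∪a , x∈D with x∈p∪q⁻ X ⁅ a ⁆ x∈X∪a
    ...   | inj₁ x∈X = ⊥-elim (X∩D=∅ (x , x∈p∩q⁺ (x∈X , x∈D)))
    ...   | inj₂ x∈a = x∈a
  X∪a-≤1 D′ D′∈L | no a∉D′ = ≤-trans (p⊆q⇒∣p∣≤∣q∣ ⊆X) (X-≤1 D′ D′∈L)
    where
    ⊆X : (X ∪ ⁅ a ⁆) ∩ D′ ⊆ X ∩ D′
    ⊆X {x} h with x∈p∩q⁻ (X ∪ ⁅ a ⁆) D′ h
    ... | x∈X∪a , x∈D′ with x∈p∪q⁻ X ⁅ a ⁆ x∈X∪a
    ...   | inj₁ x∈X = x∈p∩q⁺ (x∈X , x∈D′)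
    ...   | inj₂ x∈a = ⊥-elim (a∉D′ (subst (_∈ D′) (x∈⁅y⁆⇒x≡y a x∈a) x∈D′))

∣indep∣≤∣meeting∣ : PairwiseDisjoint L → IndepP L A →
                    (∀ D → D ∈F L → Nonempty (A ∩ D) → Nonempty (B ∩ D)) → ∣ A ∣ ≤ ∣ B ∣
∣indep∣≤∣meeting∣ {L = []} _ (A⊆⋃ , _) _ =
  ≤-trans (≤-reflexive (Empty⇒∣p∣≡0 λ (x , x∈A) → ¬Any[] (proj₁ (proj₂ (A⊆⋃ x x∈A))))) z≤n
∣indep∣≤∣meeting∣ {L = D ∷ L} {A = A} {B = B} disj indA A≼B = begin
  ∣ A ∣                 ≡⟨ ∣p∣≡∣p∩q∣+∣p─q∣ A D ⟩
  ∣ A ∩ D ∣ + ∣ A ─ D ∣ ≤⟨ +-mono-≤ in-D outside-D ⟩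
  ∣ B ∩ D ∣ + ∣ B ─ D ∣ ≡⟨ ∣p∣≡∣p∩q∣+∣p─q∣ B D ⟨
  ∣ B ∣                 ∎
  where
  open ≤-Reasoning
  in-D : ∣ A ∩ D ∣ ≤ ∣ B ∩ D ∣
  in-D with nonempty? (A ∩ D)
  ... | yes A∩D≠∅ = ≤-trans (proj₂ indA D (here refl)) (Nonempty⇒1≤∣p∣ (A≼B D (here refl) A∩D≠∅))
  ... | no  A∩D=∅ = ≤-trans (≤-reflexive (Empty⇒∣p∣≡0 A∩D=∅)) z≤n
  -- The witness in B ∩ D′ lies outside D: otherwise D′ = D, which A ─ D cannot meet.
  A─D≼B─D : ∀ D′ → D′ ∈F L → Nonempty ((A ─ D) ∩ D′) → Nonempty ((B ─ D) ∩ D′)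
  A─D≼B─D D′ D′∈L (x , x∈A─D∩D′) with x∈p∩q⁻ (A ─ D) D′ x∈A─D∩D′
  ... | x∈A─D , x∈D′ with A≼B D′ (there D′∈L) (x , x∈p∩q⁺ (p─q⊆p A D x∈A─D , x∈D′))
  ...   | y , y∈B∩D′ with x∈p∩q⁻ B D′ y∈B∩D′
  ...     | y∈B , y∈D′ = y , x∈p∩q⁺ (x∈p∧x∉q⇒x∈p─q y∈B y∉D , y∈D′)
    where
    y∉D : y ∉ D
    y∉D y∈D with same-block disj (here refl) (there D′∈L) y∈D y∈D′
    ... | refl = x∈p─q⇒x∉q A D x∈A─D x∈D′
  outside-D : ∣ A ─ D ∣ ≤ ∣ B ─ D ∣
  outside-D = ∣indep∣≤∣meeting∣ (disjoint-tail disj) (indep-─-head indA) A─D≼B─D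

indep-missing⇒1+∣A∣≤∣B∣ : PairwiseDisjoint L → IndepP L A → D ∈F L → Empty (A ∩ D) → MeetsAll B L →
                          suc ∣ A ∣ ≤ ∣ B ∣
indep-missing⇒1+∣A∣≤∣B∣ {A = A} {D = D} disj indA D∈L A∩D=∅ B-meets
  with B-meets D D∈L
... | b , b∈B∩D = begin
  suc ∣ A ∣       ≡⟨ x∉p⇒∣p∪⁅x⁆∣≡1+∣p∣ A b∉A ⟨
  ∣ A ∪ ⁅ b ⁆ ∣   ≤⟨ ∣indep∣≤∣meeting∣ disj (indep-∪⁅⁆ disj indA D∈L A∩D=∅ b∈D)
                       (λ D′ D′∈L _ → B-meets D′ D′∈L) ⟩
  _               ∎
  where
  open ≤-Reasoning
  b∈D : b ∈ D
  b∈D = p∩q⊆q _ D b∈B∩D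
  b∉A : b ∉ A
  b∉A b∈A = A∩D=∅ (b , x∈p∩q⁺ (b∈A , b∈D))

pick : Subset n → Subset n
pick D with nonempty? D
... | yes (x , _) = ⁅ x ⁆
... | no  _       = ⊥

pick⊆ : pick D ⊆ D
pick⊆ {D = D} with nonempty? D
... | yes (x , x∈D) = x∈p⇒⁅x⁆⊆p x∈D
... | no  _         = ⊥⊆

∣pick∣≤1 : ∣ pick D ∣ ≤ 1
∣pick∣≤1 {n} {D = D} with nonempty? D
... | yes (x , _) = ≤-reflexive (∣⁅x⁆∣≡1 x)
... | no  _       = ≤-trans (≤-reflexive (∣⊥∣≡0 n)) z≤n

pick-nonempty : Nonempty D → Nonempty (pick D)
pick-nonempty {D = D} D≠∅ with nonempty? D
... | yes (x , _) = x , x∈⁅x⁆ x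
... | no  D=∅     = ⊥-elim (D=∅ D≠∅)

transversal : Family n → Subset n
transversal []      = ⊥
transversal (D ∷ L) = pick D ∪ transversal L

∈transversal⁻ : (L : Family n) → x ∈ transversal L → ∃ λ D → D ∈F L × x ∈ pick D
∈transversal⁻ [] x∈⊥ = ⊥-elim (∉⊥ x∈⊥)
∈transversal⁻ (D ∷ L) x∈T with x∈p∪q⁻ (pick D) (transversal L) x∈T
... | inj₁ x∈pickD = D , here refl , x∈pickD
... | inj₂ x∈TL with ∈transversal⁻ L x∈TL
...   | D′ , D′∈L , x∈pickD′ = D′ , there D′∈L , x∈pickD′

pick⊆transversal : D ∈F L → pick D ⊆ transversal L
pick⊆transversal {L = D ∷ L} (here refl) = p⊆p∪q (transversal L)
pick⊆transversal {L = D ∷ L} (there D′∈L) x∈pickD′ =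
  q⊆p∪q (pick D) (transversal L) (pick⊆transversal D′∈L x∈pickD′)

transversal-indep : PairwiseDisjoint L → IndepP L (transversal L)
transversal-indep {L = L} disj = T⊆⋃ , T-≤1
  where
  T⊆⋃ : ∀ x → x ∈ transversal L → x ∈⋃ L
  T⊆⋃ x x∈T with ∈transversal⁻ L x∈T
  ... | D , D∈L , x∈pickD = D , D∈L , pick⊆ x∈pickD
  T∩D⊆pickD : ∀ D → D ∈F L → transversal L ∩ D ⊆ pick D
  T∩D⊆pickD D D∈L h with x∈p∩q⁻ (transversal L) D h
  ... | x∈T , x∈D with ∈transversal⁻ L x∈T
  ...   | D′ , D′∈L , x∈pickD′ with same-block disj D′∈L D∈L (pick⊆ x∈pickD′) x∈D
  ...     | refl = x∈pickD′
  T-≤1 : ∀ D → D ∈F L → ∣ transversal L ∩ D ∣ ≤ 1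
  T-≤1 D D∈L = ≤-trans (p⊆q⇒∣p∣≤∣q∣ (T∩D⊆pickD D D∈L)) (∣pick∣≤1 {D = D})

transversal-meetsAll : MembersNonempty L → MeetsAll (transversal L) L
transversal-meetsAll blocks≠∅ D D∈L with pick-nonempty (blocks≠∅ D D∈L)
... | x , x∈pickD = x , x∈p∩q⁺ (pick⊆transversal D∈L x∈pickD , pick⊆ x∈pickD)

module MatroidFacts {n : ℕ} (Indep : Subset n → Set) where
  open MatroidNotions Indep

  IsRank-unique : IsRank X k → IsRank X k′ → k ≡ k′
  IsRank-unique ((A , A⊆X , indA , ∣A∣≡k) , ≤k) ((A′ , A′⊆X , indA′ , ∣A′∣≡k′) , ≤k′) =
    ≤-antisym (subst (_≤ _) ∣A∣≡k (≤k′ A A⊆X indA)) (subst (_≤ _) ∣A′∣≡k′ (≤k A′ A′⊆X indA′))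

  indep⇒IsRank : Indep X → IsRank X ∣ X ∣
  indep⇒IsRank {X = X} indX = (X , id , indX , refl) , λ _ A⊆X _ → p⊆q⇒∣p∣≤∣q∣ A⊆X

  IsK-unique : IsK X K → IsK X K′ → K ≡ K′
  IsK-unique K-spec K′-spec = ⊆-antisym (λ {a} a∈K → proj₂ (K′-spec a) (proj₁ (K-spec a) a∈K))
                                        (λ {a} a∈K′ → proj₂ (K-spec a) (proj₁ (K′-spec a) a∈K′))

module PartitionMatroid {n : ℕ} (P : Family n) (P≠∅ : FamilyNonempty P)
                        (blocks≠∅ : MembersNonempty P) (disj : PairwiseDisjoint P) where
  open MatroidNotions (IndepP P)
  open MatroidFacts (IndepP P)

  basis : Subset n
  basis = transversal P

  basis-indep : IndepP P basis
  basis-indep = transversal-indep disj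

  rank : ℕ
  rank = ∣ basis ∣

  ∣indep∣≤rank : IndepP P A → ∣ A ∣ ≤ rank
  ∣indep∣≤rank indA = ∣indep∣≤∣meeting∣ disj indA (λ D D∈P _ → transversal-meetsAll blocks≠∅ D D∈P)

  rank≤∣meetsAll∣ : MeetsAll B P → rank ≤ ∣ B ∣
  rank≤∣meetsAll∣ B-meets = ∣indep∣≤∣meeting∣ disj basis-indep (λ D D∈P _ → B-meets D D∈P)

  indep-missing⇒1+∣A∣≤rank : IndepP P A → D ∈F P → Empty (A ∩ D) → suc ∣ A ∣ ≤ rank
  indep-missing⇒1+∣A∣≤rank indA D∈P A∩D=∅ =
    indep-missing⇒1+∣A∣≤∣B∣ disj indA D∈P A∩D=∅ (transversal-meetsAll blocks≠∅)

  IsRankM-rank : IsRankM rank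
  IsRankM-rank = (basis , ⊆⊤ , basis-indep , refl) , λ _ _ → ∣indep∣≤rank

  1≤rank : 1 ≤ rank
  1≤rank = subst (λ m → suc m ≤ rank) (∣⊥∣≡0 n)
    (indep-missing⇒1+∣A∣≤rank (indep-⊆ ⊥⊆ basis-indep) (proj₂ P≠∅) (λ (_ , h) → ∉⊥ (p∩q⊆p ⊥ _ h)))

  InS⇒1+∣X∣≡rank : InS X → suc ∣ X ∣ ≡ rank
  InS⇒1+∣X∣≡rank {X = X} (_ , ∣X∣≡r∸1) = begin
    suc ∣ X ∣        ≡⟨ cong suc (∣X∣≡r∸1 rank IsRankM-rank) ⟩
    1 + (rank ∸ 1)   ≡⟨ +-comm 1 (rank ∸ 1) ⟩
    (rank ∸ 1) + 1   ≡⟨ m∸n+n≡m 1≤rank ⟩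
    rank             ∎
    where open ≡-Reasoning

  1+∣X∣≡rank⇒InS : IndepP P X → suc ∣ X ∣ ≡ rank → InS X
  1+∣X∣≡rank⇒InS indX 1+∣X∣≡rank =
    indX , λ r rank-r → cong (_∸ 1) (trans 1+∣X∣≡rank (IsRank-unique IsRankM-rank rank-r))

  indep-below-rank-misses : IndepP P X → suc ∣ X ∣ ≡ rank → MissesSome X P
  indep-below-rank-misses {X = X} indX 1+∣X∣≡rank with missesSome-or-meetsAll X P
  ... | inj₁ misses    = misses
  ... | inj₂ X-meets = ⊥-elim (1+n≰n (subst (_≤ ∣ X ∣) (sym 1+∣X∣≡rank) (rank≤∣meetsAll∣ X-meets)))

  IsK-missed-block : IndepP P X → D ∈F P → Empty (X ∩ D) → suc ∣ X ∣ ≡ rank → IsK X D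
  IsK-missed-block {X = X} {D = D} indX D∈P X∩D=∅ 1+∣X∣≡rank a = raises , raised⇒∈D
    where
    raises : a ∈ D → ∃ λ k → IsRank X k × IsRank (X ∪ ⁅ a ⁆) (suc k)
    raises a∈D = ∣ X ∣ , indep⇒IsRank indX ,
      subst (IsRank (X ∪ ⁅ a ⁆)) (x∉p⇒∣p∪⁅x⁆∣≡1+∣p∣ X a∉X) (indep⇒IsRank (indep-∪⁅⁆ disj indX D∈P X∩D=∅ a∈D))
      where
      a∉X : a ∉ X
      a∉X a∈X = X∩D=∅ (a , x∈p∩q⁺ (a∈X , a∈D))
    raised⇒∈D : (∃ λ k → IsRank X k × IsRank (X ∪ ⁅ a ⁆) (suc k)) → a ∈ D
    raised⇒∈D (k , rank-X , ((A , A⊆X∪a , indA , ∣A∣≡1+k) , _)) with a ∈? D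
    ... | yes a∈D = a∈D
    ... | no  a∉D =
      ⊥-elim (1+n≰n (subst (λ m → suc m ≤ rank) ∣A∣≡rank (indep-missing⇒1+∣A∣≤rank indA D∈P A∩D=∅)))
      where
      ∣A∣≡rank : ∣ A ∣ ≡ rank
      ∣A∣≡rank = trans ∣A∣≡1+k (trans (cong suc (IsRank-unique rank-X (indep⇒IsRank indX))) 1+∣X∣≡rank)
      A∩D=∅ : Empty (A ∩ D)
      A∩D=∅ (x , x∈A∩D) with x∈p∩q⁻ A D x∈A∩D
      ... | x∈A , x∈D with x∈p∪q⁻ X ⁅ a ⁆ (A⊆X∪a x∈A)
      ...   | inj₁ x∈X = X∩D=∅ (x , x∈p∩q⁺ (x∈X , x∈D))
      ...   | inj₂ x∈a = a∉D (subst (_∈ D) (x∈⁅y⁆⇒x≡y a x∈a) x∈D)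

  InF⇒∈P : InF K → K ∈F P
  InF⇒∈P (X , X∈s@(indX , _) , K-spec) with indep-below-rank-misses indX (InS⇒1+∣X∣≡rank X∈s)
  ... | D , D∈P , X∩D=∅ =
    subst (_∈F P) (IsK-unique (IsK-missed-block indX D∈P X∩D=∅ (InS⇒1+∣X∣≡rank X∈s)) K-spec) D∈P

  ∈P⇒InF : K ∈F P → InF K
  ∈P⇒InF {K = K} K∈P = Y , 1+∣X∣≡rank⇒InS indY 1+∣Y∣≡rank , IsK-missed-block indY K∈P Y∩K=∅ 1+∣Y∣≡rank
    where
    Y : Subset n
    Y = basis ─ K
    indY : IndepP P Y
    indY = indep-⊆ (p─q⊆p basis K) basis-indep
    Y∩K=∅ : Empty (Y ∩ K)
    Y∩K=∅ (_ , h) = x∈p─q⇒x∉q basis K (p∩q⊆p Y K h) (p∩q⊆q Y K h)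
    k₀ : Fin n
    k₀ = proj₁ (blocks≠∅ K K∈P)
    k₀∈K : k₀ ∈ K
    k₀∈K = proj₂ (blocks≠∅ K K∈P)
    Y∪k₀-meets : MeetsAll (Y ∪ ⁅ k₀ ⁆) P
    Y∪k₀-meets D D∈P with k₀ ∈? D | pick-nonempty (blocks≠∅ D D∈P)
    ... | yes k₀∈D | _ = k₀ , x∈p∩q⁺ (q⊆p∪q Y ⁅ k₀ ⁆ (x∈⁅x⁆ k₀) , k₀∈D)
    ... | no  k₀∉D | x , x∈pickD =
      x , x∈p∩q⁺ (p⊆p∪q ⁅ k₀ ⁆ (x∈p∧x∉q⇒x∈p─q (pick⊆transversal D∈P x∈pickD) x∉K) , pick⊆ x∈pickD)
      where
      x∉K : x ∉ K
      x∉K x∈K with same-block disj K∈P D∈P x∈K (pick⊆ x∈pickD)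
      ... | refl = k₀∉D k₀∈K
    1+∣Y∣≡rank : suc ∣ Y ∣ ≡ rank
    1+∣Y∣≡rank = trans (sym (x∉p⇒∣p∪⁅x⁆∣≡1+∣p∣ Y (λ k₀∈Y → Y∩K=∅ (k₀ , x∈p∩q⁺ (k₀∈Y , k₀∈K)))))
                       (≤-antisym (∣indep∣≤rank (indep-∪⁅⁆ disj indY K∈P Y∩K=∅ k₀∈K))
                                  (rank≤∣meetsAll∣ Y∪k₀-meets))

theorem6 : (n : ℕ) (P : Family n) → FamilyNonempty P → MembersNonempty P → PairwiseDisjoint P →
    (K : Subset n) → (MatroidNotions.InF (IndepP P) K → K ∈F P) × (K ∈F P → MatroidNotions.InF (IndepP P) K)
theorem6 n P P≠∅ blocks≠∅ disj K = InF⇒∈P , ∈P⇒InF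
  where open PartitionMatroid P P≠∅ blocks≠∅ disj
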